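{- Let $n$ be an odd positive integer and $S=\{0,\dots,n-1\}$. For $q=1,2,3$ let $\alpha_{1q},\alpha_{2q},\alpha_{3q}\in\{1,\dots,n-1\}$ satisfy, for each $q$ (writing $\alpha_\ell=\alpha_{\ell q}$, $A=\alpha_1+\alpha_2+\alpha_3$): $\gcd(\alpha_\ell,n)=1$; $\gcd(\alpha_\ell\pm\alpha_{\ell'},n)=1$ for $\ell\ne\ell'$; $\gcd(A,n)=1$; $\gcd(A-2\alpha_\ell,n)=1$; and suppose $\gcd(\det(\alpha_{pq})_{p,q=1}^3,n)=1$. Let $C^{(q)}_{ijk}\equiv\alpha_{1q}i+\alpha_{2q}j+\alpha_{3q}k\pmod n$ with entries in $S$ (three orthogonal pandiagonal latin cubes), and define $M^{(3)}=n^2C^{(1)}+nC^{(2)}+C^{(3)}$ entrywise. Then $M^{(3)}$ is a magic pandiagonal cube.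
   Context: For an $n\times n$ array indexed by $(x,y)\in S^2$, its ROWS are, for each $c\in S$, the index sets $\{(x,c)\}_x$, $\{(c,y)\}_y$, $\{(x,x+c\bmod n)\}_x$, $\{(x,c-x\bmod n)\}_x$. The $3n+6$ constituent squares of an $n\times n\times n$ array $(M_{ijk})$ are the $3n$ squares obtained by fixing one of $i,j,k$, and the six squares $(M_{iik})_{i,k}$, $(M_{i,n-1-i,k})_{i,k}$, $(M_{iji})_{i,j}$, $(M_{i,j,n-1-i})_{i,j}$, $(M_{ijj})_{i,j}$, $(M_{i,j,n-1-j})_{i,j}$. An $n\times n\times n$ array $M$ is a magic pandiagonal cube if its entries are exactly the integers $0,1,\dots,n^3-1$, each occurring once, and the sum of the entries along every ROW of every constituent square equals $n(n^3-1)/2$. -}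

module Defs where

open import Data.Nat using (ℕ; zero; suc; _+_; _*_; _∸_; _^_; _≤_; _<_; NonZero)
open import Data.Nat.DivMod using (_%_; _/_)
open import Data.Nat.GCD using (gcd)
open import Data.Integer as ℤ using (ℤ; +_; ∣_∣)
open import Data.List using (List; map; upTo)
open import Data.Nat.ListAction using (sum)
open import Data.Fin using (Fin; zero; suc)
open import Data.Product using (_×_; _,_; Σ; ∃)
open import Relation.Binary.PropositionalEquality using (_≡_; _≢_)

Σ< : ℕ → (ℕ → ℕ) → ℕ
Σ< n f = sum (map f (upTo n))

CoprimeZ : ℤ → ℕ → Set
CoprimeZ z n = gcd ∣ z ∣ n ≡ 1

det3 : (Fin 3 → Fin 3 → ℤ) → ℤ
det3 a = a0 0 0 ℤ.* (a0 1 1 ℤ.* a0 2 2 ℤ.- a0 1 2 ℤ.* a0 2 1)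
       ℤ.- a0 0 1 ℤ.* (a0 1 0 ℤ.* a0 2 2 ℤ.- a0 1 2 ℤ.* a0 2 0)
       ℤ.+ a0 0 2 ℤ.* (a0 1 0 ℤ.* a0 2 1 ℤ.- a0 1 1 ℤ.* a0 2 0)
  where
    a0 : ℕ → ℕ → ℤ
    a0 p q = a (f p) (f q)
      where
        f : ℕ → Fin 3
        f 0 = zero
        f 1 = suc zero
        f _ = suc (suc zero)

Square : Set
Square = ℕ → ℕ → ℕ

Cube : Set
Cube = ℕ → ℕ → ℕ → ℕ

RowsSum : (n : ℕ) .{{_ : NonZero n}} → Square → ℕ → Set
RowsSum n Q s = (c : ℕ) → c < n →
    (Σ< n (λ x → Q x c) ≡ s)
  × (Σ< n (λ y → Q c y) ≡ s)
  × (Σ< n (λ x → Q x ((x + c) % n)) ≡ s)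
  × (Σ< n (λ x → Q x ((c + (n ∸ x)) % n)) ≡ s)   -- (c - x) mod n, for x < n

-- the 3n+6 constituent squares; all their ROWS sum to s
ConstituentRowsSum : (n : ℕ) .{{_ : NonZero n}} → Cube → ℕ → Set
ConstituentRowsSum n M s =
    ((c : ℕ) → c < n → RowsSum n (λ j k → M c j k) s)
  × ((c : ℕ) → c < n → RowsSum n (λ i k → M i c k) s)
  × ((c : ℕ) → c < n → RowsSum n (λ i j → M i j c) s)
  × RowsSum n (λ i k → M i i k) s
  × RowsSum n (λ i k → M i (n ∸ 1 ∸ i) k) s
  × RowsSum n (λ i j → M i j i) s
  × RowsSum n (λ i j → M i j (n ∸ 1 ∸ i)) s
  × RowsSum n (λ i j → M i j j) s
  × RowsSum n (λ i j → M i j (n ∸ 1 ∸ j)) s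

EntriesExactly : ℕ → Cube → Set
EntriesExactly n M =
    ((i j k : ℕ) → i < n → j < n → k < n → M i j k < n ^ 3)
  × ((v : ℕ) → v < n ^ 3 →
       Σ (ℕ × ℕ × ℕ) λ { (i , j , k) →
         (i < n × j < n × k < n × M i j k ≡ v)
         × ((i' j' k' : ℕ) → i' < n → j' < n → k' < n → M i' j' k' ≡ v →
              (i' , j' , k') ≡ (i , j , k)) })

MagicPandiagonalCube : (n : ℕ) .{{_ : NonZero n}} → Cube → Set
MagicPandiagonalCube n M =
  EntriesExactly n M × ConstituentRowsSum n M ((n * (n ^ 3 ∸ 1)) / 2)

-- α is indexed as α p q = α_{p+1,q+1}
-- hypotheses on the column q of α
ColumnConditions : ℕ → (Fin 3 → Fin 3 → ℕ) → Fin 3 → Set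
ColumnConditions n α q =
    ((ℓ : Fin 3) → 1 ≤ α ℓ q × α ℓ q ≤ n ∸ 1)
  × ((ℓ : Fin 3) → gcd (α ℓ q) n ≡ 1)
  × ((ℓ ℓ' : Fin 3) → ℓ ≢ ℓ' →
       CoprimeZ (+ α ℓ q ℤ.+ + α ℓ' q) n × CoprimeZ (+ α ℓ q ℤ.- + α ℓ' q) n)
  × CoprimeZ A n
  × ((ℓ : Fin 3) → CoprimeZ (A ℤ.- + 2 ℤ.* + α ℓ q) n)
  where
    A : ℤ
    A = + α zero q ℤ.+ + α (suc zero) q ℤ.+ + α (suc (suc zero)) q

latinC : (n : ℕ) .{{_ : NonZero n}} → (Fin 3 → Fin 3 → ℕ) → Fin 3 → Cube
latinC n α q i j k =
  (α zero q * i + α (suc zero) q * j + α (suc (suc zero)) q * k) % n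

M3 : (n : ℕ) .{{_ : NonZero n}} → (Fin 3 → Fin 3 → ℕ) → Cube
M3 n α i j k =
  n ^ 2 * latinC n α zero i j k + n * latinC n α (suc zero) i j k
    + latinC n α (suc (suc zero)) i j k

-- Write a cube index as a point u ∈ S³ and let A = (α_pq).  Then C^(q)_u ≡ (Aᵀu)_q (mod n), so
-- the entry M^(3)_u = n² C^(1)_u + n C^(2)_u + C^(3)_u has the base-n digits Aᵀu mod n.  As det A
-- is a unit mod n, u ↦ Aᵀu is a bijection of S³ (inverted by (det A)⁻¹ adj(A)ᵀ), so the entries
-- are exactly 0, …, n³-1.  Every ROW of a constituent square is a line x ↦ x d + e (mod n) with
-- d ∈ {-1,0,1}³ nonzero, along which C^(q) is x ↦ (Aᵀd)_q x + const.  The hypotheses make each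
-- (Aᵀd)_q a unit, so each digit runs through S once and the row sums to
-- (n² + n + 1)(0 + 1 + ⋯ + (n-1)) = n(n³-1)/2.

module Submission where

open import Algebra.Bundles.Raw using (RawRing)
open import Data.Fin using (Fin; zero; suc; #_)
open import Data.Nat as ℕ using (ℕ; zero; suc; NonZero; _^_; _∸_; _/_)
import Data.Nat.Properties as ℕ
open import Data.Nat.DivMod using (_%_; m%n<n; m*n/n≡m; m≡m%n+[m/n]*n; m<n⇒m%n≡m; [m+kn]%n≡m%n)
open import Data.Nat.GCD using (gcd; gcd-GCD; module Bézout)
import Data.Nat.Tactic.RingSolver as ℕ-Solver
open import Data.Product using (_×_; _,_; ∃; proj₁; proj₂)
open import Data.Vec using (Vec; _∷_; [])
open import Data.Vec.N-ary using (N-ary; appⁿ-cong)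
open import Relation.Binary.Bundles using (Setoid)
open import Relation.Binary.PropositionalEquality hiding ([_])
open import Relation.Nullary using (yes; no; contradiction)
import Relation.Binary.Reasoning.Setoid as SetoidReasoning
open import Defs

module FiniteSums where

  open import Data.Nat using (_+_; _*_; _<_; _≟_)
  open import Data.Nat.Properties
  open import Data.List using (map; upTo; _++_; [_])
  open import Data.List.Properties using (upTo-∷ʳ; map-++)
  open import Data.Nat.ListAction using (sum)
  open import Data.Nat.ListAction.Properties using (sum-++)
  open import Data.Nat.Tactic.RingSolver using (solve-∀)
  open import Function using (_∘_)

  private variable
    n : ℕ
    f g : ℕ → ℕ

  Σ<-suc : ∀ n f → Σ< (suc n) f ≡ Σ< n f + f n
  Σ<-suc n f = begin
    sum (map f (upTo (suc n)))      ≡⟨ cong (sum ∘ map f) (upTo-∷ʳ n) ⟨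
    sum (map f (upTo n ++ [ n ]))   ≡⟨ cong sum (map-++ f (upTo n) [ n ]) ⟩
    sum (map f (upTo n) ++ [ f n ]) ≡⟨ sum-++ (map f (upTo n)) [ f n ] ⟩
    Σ< n f + (f n + 0)              ≡⟨ cong (Σ< n f +_) (+-identityʳ (f n)) ⟩
    Σ< n f + f n                    ∎
    where open ≡-Reasoning

  Σ<-cong : (∀ x → x < n → f x ≡ g x) → Σ< n f ≡ Σ< n g
  Σ<-cong {zero}  f≡g = refl
  Σ<-cong {suc n} {f} {g} f≡g = begin
    Σ< (suc n) f ≡⟨ Σ<-suc n f ⟩
    Σ< n f + f n ≡⟨ cong₂ _+_ (Σ<-cong (λ x x<n → f≡g x (m<n⇒m<1+n x<n))) (f≡g n ≤-refl) ⟩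
    Σ< n g + g n ≡⟨ Σ<-suc n g ⟨
    Σ< (suc n) g ∎
    where open ≡-Reasoning

  Σ<-+ : ∀ n f g → Σ< n (λ x → f x + g x) ≡ Σ< n f + Σ< n g
  Σ<-+ zero    f g = refl
  Σ<-+ (suc n) f g = begin
    Σ< (suc n) (λ x → f x + g x)       ≡⟨ Σ<-suc n _ ⟩
    Σ< n (λ x → f x + g x) + (f n + g n) ≡⟨ cong (_+ (f n + g n)) (Σ<-+ n f g) ⟩
    Σ< n f + Σ< n g + (f n + g n)      ≡⟨ +-+-interchange (Σ< n f) (Σ< n g) (f n) (g n) ⟩
    (Σ< n f + f n) + (Σ< n g + g n)    ≡⟨ cong₂ _+_ (Σ<-suc n f) (Σ<-suc n g) ⟨
    Σ< (suc n) f + Σ< (suc n) g        ∎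
    where
      open ≡-Reasoning
      +-+-interchange : ∀ a b c d → a + b + (c + d) ≡ (a + c) + (b + d)
      +-+-interchange = solve-∀

  Σ<-*ˡ : ∀ n k f → Σ< n (λ x → k * f x) ≡ k * Σ< n f
  Σ<-*ˡ zero    k f = sym (*-zeroʳ k)
  Σ<-*ˡ (suc n) k f = begin
    Σ< (suc n) (λ x → k * f x)   ≡⟨ Σ<-suc n _ ⟩
    Σ< n (λ x → k * f x) + k * f n ≡⟨ cong (_+ k * f n) (Σ<-*ˡ n k f) ⟩
    k * Σ< n f + k * f n         ≡⟨ *-distribˡ-+ k (Σ< n f) (f n) ⟨
    k * (Σ< n f + f n)           ≡⟨ cong (k *_) (Σ<-suc n f) ⟨
    k * Σ< (suc n) f             ∎
    where open ≡-Reasoning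

  Σ<-zero : (∀ x → x < n → f x ≡ 0) → Σ< n f ≡ 0
  Σ<-zero {zero}  f≡0 = refl
  Σ<-zero {suc n} {f} f≡0 = trans (Σ<-suc n f)
    (cong₂ _+_ (Σ<-zero (λ x x<n → f≡0 x (m<n⇒m<1+n x<n))) (f≡0 n ≤-refl))

  Σ<-swap : ∀ n m (F : ℕ → ℕ → ℕ) → Σ< n (λ x → Σ< m (F x)) ≡ Σ< m (λ y → Σ< n (λ x → F x y))
  Σ<-swap zero    m F = sym (Σ<-zero {m} (λ _ _ → refl))
  Σ<-swap (suc n) m F = begin
    Σ< (suc n) (λ x → Σ< m (F x))                       ≡⟨ Σ<-suc n _ ⟩
    Σ< n (λ x → Σ< m (F x)) + Σ< m (F n)                ≡⟨ cong (_+ Σ< m (F n)) (Σ<-swap n m F) ⟩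
    Σ< m (λ y → Σ< n (λ x → F x y)) + Σ< m (F n)        ≡⟨ Σ<-+ m _ (F n) ⟨
    Σ< m (λ y → Σ< n (λ x → F x y) + F n y)             ≡⟨ Σ<-cong {m} (λ y _ → Σ<-suc n (λ x → F x y)) ⟨
    Σ< m (λ y → Σ< (suc n) (λ x → F x y))               ∎
    where open ≡-Reasoning

  Σ<-single : ∀ {x₀} → x₀ < n → (∀ x → x < n → x ≢ x₀ → f x ≡ 0) → Σ< n f ≡ f x₀
  Σ<-single {suc n} {f} {x₀} x₀<1+n f≡0 with x₀ ≟ n
  ... | yes refl = begin
    Σ< (suc n) f ≡⟨ Σ<-suc n f ⟩
    Σ< n f + f n ≡⟨ cong (_+ f n) (Σ<-zero (λ x x<n → f≡0 x (m<n⇒m<1+n x<n) (<⇒≢ x<n))) ⟩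
    f n          ∎
    where open ≡-Reasoning
  ... | no x₀≢n = begin
    Σ< (suc n) f ≡⟨ Σ<-suc n f ⟩
    Σ< n f + f n ≡⟨ cong₂ _+_ (Σ<-single x₀<n (λ x x<n → f≡0 x (m<n⇒m<1+n x<n)))
                              (f≡0 n ≤-refl (x₀≢n ∘ sym)) ⟩
    f x₀ + 0     ≡⟨ +-identityʳ (f x₀) ⟩
    f x₀         ∎
    where
      open ≡-Reasoning
      x₀<n = ≤∧≢⇒< (≤-pred x₀<1+n) x₀≢n

  Σ<-reindex : ∀ n f (g : ℕ → ℕ) → (∀ x → x < n → g x < n) →
               (∀ x y → x < n → y < n → g x ≡ g y → x ≡ y) →
               (∀ y → y < n → ∃ λ x → x < n × g x ≡ y) →
               Σ< n (f ∘ g) ≡ Σ< n f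
  Σ<-reindex n f g g<n g-injective g-surjective = begin
    Σ< n (f ∘ g)                        ≡⟨ Σ<-cong (λ x x<n → δ-row (g x) (g<n x x<n)) ⟨
    Σ< n (λ x → Σ< n (λ y → δ (g x) y)) ≡⟨ Σ<-swap n n _ ⟩
    Σ< n (λ y → Σ< n (λ x → δ (g x) y)) ≡⟨ Σ<-cong δ-column ⟩
    Σ< n f                              ∎
    where
      open ≡-Reasoning
      δ : ℕ → ℕ → ℕ
      δ z y with z ≟ y
      ... | yes _ = f y
      ... | no _  = 0

      δ-refl : ∀ y → δ y y ≡ f y
      δ-refl y with y ≟ y
      ... | yes _   = refl
      ... | no y≢y = contradiction refl y≢y

      δ-≢ : ∀ {z y} → z ≢ y → δ z y ≡ 0
      δ-≢ {z} {y} z≢y with z ≟ y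
      ... | yes z≡y = contradiction z≡y z≢y
      ... | no _    = refl

      δ-row : ∀ z → z < n → Σ< n (δ z) ≡ f z
      δ-row z z<n = trans (Σ<-single z<n (λ y _ y≢z → δ-≢ (y≢z ∘ sym))) (δ-refl z)

      δ-column : ∀ y → y < n → Σ< n (λ x → δ (g x) y) ≡ f y
      δ-column y y<n with g-surjective y y<n
      ... | x₀ , x₀<n , refl = trans
        (Σ<-single x₀<n (λ x x<n x≢x₀ → δ-≢ (x≢x₀ ∘ g-injective x x₀ x<n x₀<n)))
        (δ-refl (g x₀))

  Σ<-id : ∀ n → 2 * Σ< n (λ x → x) ≡ n * (n ∸ 1)
  Σ<-id zero          = refl
  Σ<-id (suc zero)    = refl
  Σ<-id (suc (suc n)) = begin
    2 * Σ< (2 + n) (λ x → x)           ≡⟨ cong (2 *_) (Σ<-suc (suc n) (λ x → x)) ⟩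
    2 * (Σ< (1 + n) (λ x → x) + (1 + n)) ≡⟨ *-distribˡ-+ 2 (Σ< (suc n) (λ x → x)) (suc n) ⟩
    2 * Σ< (1 + n) (λ x → x) + 2 * (1 + n) ≡⟨ cong (_+ 2 * suc n) (Σ<-id (suc n)) ⟩
    (1 + n) * n + 2 * (1 + n)          ≡⟨ step n ⟩
    (2 + n) * (1 + n)                  ∎
    where
      open ≡-Reasoning
      step : ∀ n → (1 + n) * n + 2 * (1 + n) ≡ (2 + n) * (1 + n)
      step = solve-∀

open FiniteSums

module Linear3 {c ℓ} (R : RawRing c ℓ) where

  open RawRing R

  Vector3 : Set c
  Vector3 = Fin 3 → Carrier

  Matrix3 : Set c
  Matrix3 = Fin 3 → Fin 3 → Carrier

  vector3 : Carrier → Carrier → Carrier → Vector3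
  vector3 x y z zero             = x
  vector3 x y z (suc zero)       = y
  vector3 x y z (suc (suc zero)) = z

  matrix3 : (a₀₀ a₀₁ a₀₂ a₁₀ a₁₁ a₁₂ a₂₀ a₂₁ a₂₂ : Carrier) → Matrix3
  matrix3 a₀₀ a₀₁ a₀₂ a₁₀ a₁₁ a₁₂ a₂₀ a₂₁ a₂₂ zero             = vector3 a₀₀ a₀₁ a₀₂
  matrix3 a₀₀ a₀₁ a₀₂ a₁₀ a₁₁ a₁₂ a₂₀ a₂₁ a₂₂ (suc zero)       = vector3 a₁₀ a₁₁ a₁₂
  matrix3 a₀₀ a₀₁ a₀₂ a₁₀ a₁₁ a₁₂ a₂₀ a₂₁ a₂₂ (suc (suc zero)) = vector3 a₂₀ a₂₁ a₂₂

  infix 9 _·_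
  _·_ : Vector3 → Vector3 → Carrier
  u · v = u zero * v zero + u (suc zero) * v (suc zero) + u (suc (suc zero)) * v (suc (suc zero))

  column : Matrix3 → Fin 3 → Vector3
  column A q p = A p q

  infixr 7 _ᵀ*_
  _ᵀ*_ : Matrix3 → Vector3 → Vector3
  (A ᵀ* u) q = column A q · u

  -- The expansion of det3, so that det agrees with it definitionally.
  det : Matrix3 → Carrier
  det a = a (# 0) (# 0) * (a (# 1) (# 1) * a (# 2) (# 2) + - (a (# 1) (# 2) * a (# 2) (# 1)))
        + - (a (# 0) (# 1) * (a (# 1) (# 0) * a (# 2) (# 2) + - (a (# 1) (# 2) * a (# 2) (# 0))))
        + a (# 0) (# 2) * (a (# 1) (# 0) * a (# 2) (# 1) + - (a (# 1) (# 1) * a (# 2) (# 0)))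

  next : Fin 3 → Fin 3
  next zero             = suc zero
  next (suc zero)       = suc (suc zero)
  next (suc (suc zero)) = zero

  -- With indices read cyclically the cofactor signs take care of themselves.
  adjugate : Matrix3 → Matrix3
  adjugate A i j = A (next j) (next i) * A (next (next j)) (next (next i))
                 + - (A (next j) (next (next i)) * A (next (next j)) (next i))

open import Data.Integer using (ℤ; +_; -[1+_]; _+_; _*_; -_; _-_)
open import Data.Integer.Base using (+-*-rawRing)
open import Data.Integer.Properties using (pos-+; pos-*; +-injective; ⊖-≥; m-n≡m⊖n; ∣-i∣≡∣i∣; *-identityˡ)
open import Data.Integer.DivMod using (_%ℕ_; _/ℕ_; n%ℕd<d; a≡a%ℕn+[a/ℕn]*n)
open import Data.Integer.Solver using (module +-*-Solver)
open import Data.Integer.Tactic.RingSolver using (solve-∀)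

open Linear3 +-*-rawRing

private
  open +-*-Solver using (Polynomial; _:+_; _:*_; :-_; con; _:=_; solve)
  -- Linear3 over the solver's polynomials: identities between its definitions are decided by solve.
  polynomialRing : ℕ → RawRing _ _
  polynomialRing m = record
    { Carrier = Polynomial m ; _≈_ = _≡_ ; _+_ = _:+_ ; _*_ = _:*_ ; -_ = :-_
    ; 0# = con (+ 0) ; 1# = con (+ 1) }

  module P {m} = Linear3 (polynomialRing m)

  coordinates : Matrix3 → Vector3 → Vec ℤ 12
  coordinates A t = A (# 0) (# 0) ∷ A (# 0) (# 1) ∷ A (# 0) (# 2)
                  ∷ A (# 1) (# 0) ∷ A (# 1) (# 1) ∷ A (# 1) (# 2)
                  ∷ A (# 2) (# 0) ∷ A (# 2) (# 1) ∷ A (# 2) (# 2)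
                  ∷ t (# 0) ∷ t (# 1) ∷ t (# 2) ∷ []

  matrixVectorEquation : (∀ {m} → P.Matrix3 {m} → P.Vector3 {m} → Polynomial m × Polynomial m) →
                         N-ary 12 (Polynomial 12) (Polynomial 12 × Polynomial 12)
  matrixVectorEquation e a₀₀ a₀₁ a₀₂ a₁₀ a₁₁ a₁₂ a₂₀ a₂₁ a₂₂ t₀ t₁ t₂ =
    e (P.matrix3 a₀₀ a₀₁ a₀₂ a₁₀ a₁₁ a₁₂ a₂₀ a₂₁ a₂₂) (P.vector3 t₀ t₁ t₂)

  adjugate-inverseʳ-at : Fin 3 → N-ary 12 (Polynomial 12) (Polynomial 12 × Polynomial 12)
  adjugate-inverseʳ-at q = matrixVectorEquation λ M u → (M P.ᵀ* P.adjugate M P.ᵀ* u) q := P.det M :* u q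

  adjugate-inverseˡ-at : Fin 3 → N-ary 12 (Polynomial 12) (Polynomial 12 × Polynomial 12)
  adjugate-inverseˡ-at q = matrixVectorEquation λ M u → (P.adjugate M P.ᵀ* M P.ᵀ* u) q := P.det M :* u q

adjugate-inverseʳ : ∀ A t q → (A ᵀ* adjugate A ᵀ* t) q ≡ det A * t q
adjugate-inverseʳ A t zero =
  appⁿ-cong _≡_ _ _ (solve 12 (adjugate-inverseʳ-at zero) refl) (coordinates A t)
adjugate-inverseʳ A t (suc zero) =
  appⁿ-cong _≡_ _ _ (solve 12 (adjugate-inverseʳ-at (suc zero)) refl) (coordinates A t)
adjugate-inverseʳ A t (suc (suc zero)) =
  appⁿ-cong _≡_ _ _ (solve 12 (adjugate-inverseʳ-at (suc (suc zero))) refl) (coordinates A t)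

adjugate-inverseˡ : ∀ A u r → (adjugate A ᵀ* A ᵀ* u) r ≡ det A * u r
adjugate-inverseˡ A u zero =
  appⁿ-cong _≡_ _ _ (solve 12 (adjugate-inverseˡ-at zero) refl) (coordinates A u)
adjugate-inverseˡ A u (suc zero) =
  appⁿ-cong _≡_ _ _ (solve 12 (adjugate-inverseˡ-at (suc zero)) refl) (coordinates A u)
adjugate-inverseˡ A u (suc (suc zero)) =
  appⁿ-cong _≡_ _ _ (solve 12 (adjugate-inverseˡ-at (suc (suc zero))) refl) (coordinates A u)

·-affine : ∀ c d e x → c · (λ p → d p * x + e p) ≡ c · d * x + c · e
·-affine c d e x = appⁿ-cong _≡_ _ _ (solve 10 (λ c₀ c₁ c₂ d₀ d₁ d₂ e₀ e₁ e₂ x →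
    let c = P.vector3 c₀ c₁ c₂ ; d = P.vector3 d₀ d₁ d₂ ; e = P.vector3 e₀ e₁ e₂ in
    c P.· (λ p → d p :* x :+ e p) := c P.· d :* x :+ c P.· e) refl)
  (c zero ∷ c (suc zero) ∷ c (suc (suc zero)) ∷ d zero ∷ d (suc zero) ∷ d (suc (suc zero))
   ∷ e zero ∷ e (suc zero) ∷ e (suc (suc zero)) ∷ x ∷ [])

·-*ʳ : ∀ c d x → c · (λ p → d p * x) ≡ c · d * x
·-*ʳ c d x = appⁿ-cong _≡_ _ _ (solve 7 (λ c₀ c₁ c₂ d₀ d₁ d₂ x →
    let c = P.vector3 c₀ c₁ c₂ ; d = P.vector3 d₀ d₁ d₂ in
    c P.· (λ p → d p :* x) := c P.· d :* x) refl)
  (c zero ∷ c (suc zero) ∷ c (suc (suc zero)) ∷ d zero ∷ d (suc zero) ∷ d (suc (suc zero)) ∷ x ∷ [])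

module Modulo (n : ℕ) .{{_ : NonZero n}} where

  infix 4 _≋_
  record _≋_ (a b : ℤ) : Set where
    constructor _,_
    field
      quotient : ℤ
      a≡b+quotient*n : a ≡ b + quotient * + n

  ≡⇒≋ : ∀ {a b} → a ≡ b → a ≋ b
  ≡⇒≋ {a} refl = + 0 , lemma a (+ n)
    where lemma : ∀ a n → a ≡ a + + 0 * n
          lemma = solve-∀

  ≋-refl : ∀ {a} → a ≋ a
  ≋-refl = ≡⇒≋ refl

  ≋-sym : ∀ {a b} → a ≋ b → b ≋ a
  ≋-sym {b = b} (k , a≡b+kn) = - k , trans (lemma b k (+ n)) (cong (_+ - k * + n) (sym a≡b+kn))
    where lemma : ∀ b k n → b ≡ b + k * n + - k * n
          lemma = solve-∀

  ≋-trans : ∀ {a b c} → a ≋ b → b ≋ c → a ≋ c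
  ≋-trans {c = c} (k , refl) (l , refl) = l + k , lemma c k l (+ n)
    where lemma : ∀ c k l n → c + l * n + k * n ≡ c + (l + k) * n
          lemma = solve-∀

  ≋-setoid : Setoid _ _
  ≋-setoid = record
    { Carrier = ℤ ; _≈_ = _≋_
    ; isEquivalence = record { refl = ≋-refl ; sym = ≋-sym ; trans = ≋-trans } }

  module ≋-Reasoning = SetoidReasoning ≋-setoid

  +-cong : ∀ {a b c d} → a ≋ b → c ≋ d → a + c ≋ b + d
  +-cong {b = b} {d = d} (k , refl) (l , refl) = k + l , lemma b d k l (+ n)
    where lemma : ∀ b d k l n → b + k * n + (d + l * n) ≡ b + d + (k + l) * n
          lemma = solve-∀

  *-cong : ∀ {a b c d} → a ≋ b → c ≋ d → a * c ≋ b * d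
  *-cong {b = b} {d = d} (k , refl) (l , refl) = k * d + b * l + k * l * + n , lemma b d k l (+ n)
    where lemma : ∀ b d k l n → (b + k * n) * (d + l * n) ≡ b * d + (k * d + b * l + k * l * n) * n
          lemma = solve-∀

  -‿cong : ∀ {a b} → a ≋ b → - a ≋ - b
  -‿cong {b = b} (k , refl) = - k , lemma b k (+ n)
    where lemma : ∀ b k n → - (b + k * n) ≡ - b + - k * n
          lemma = solve-∀

  +-congˡ : ∀ c {a b} → a ≋ b → c + a ≋ c + b
  +-congˡ c = +-cong (≋-refl {c})

  +-congʳ : ∀ c {a b} → a ≋ b → a + c ≋ b + c
  +-congʳ c a≋b = +-cong a≋b (≋-refl {c})

  *-congˡ : ∀ c {a b} → a ≋ b → c * a ≋ c * b
  *-congˡ c = *-cong (≋-refl {c})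

  *-congʳ : ∀ c {a b} → a ≋ b → a * c ≋ b * c
  *-congʳ c a≋b = *-cong a≋b (≋-refl {c})

  n≋0 : + n ≋ + 0
  n≋0 = + 1 , lemma (+ n)
    where lemma : ∀ n → n ≡ + 0 + + 1 * n
          lemma = solve-∀

  %≋ : ∀ m → + (m ℕ.% n) ≋ + m
  %≋ m = ≋-sym (+ (m ℕ./ n) , (begin
    + m                                 ≡⟨ cong +_ (m≡m%n+[m/n]*n m n) ⟩
    + (m ℕ.% n ℕ.+ m ℕ./ n ℕ.* n)       ≡⟨ pos-+ (m ℕ.% n) (m ℕ./ n ℕ.* n) ⟩
    + (m ℕ.% n) + + (m ℕ./ n ℕ.* n)     ≡⟨ cong (_+_ (+ (m ℕ.% n))) (pos-* (m ℕ./ n) n) ⟩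
    + (m ℕ.% n) + + (m ℕ./ n) * + n     ∎))
    where open ≡-Reasoning

  %ℕ≋ : ∀ a → + (a %ℕ n) ≋ a
  %ℕ≋ a = ≋-sym (a /ℕ n , a≡a%ℕn+[a/ℕn]*n a n)

  private
    +-*-injective : ∀ {r r′} k → + r ≡ + r′ + + k * + n → r ≡ r′ ℕ.+ k ℕ.* n
    +-*-injective {r} {r′} k eq = +-injective (begin
      + r                ≡⟨ eq ⟩
      + r′ + + k * + n   ≡⟨ cong (_+_ (+ r′)) (pos-* k n) ⟨
      + r′ + + (k ℕ.* n) ≡⟨ pos-+ r′ (k ℕ.* n) ⟨
      + (r′ ℕ.+ k ℕ.* n) ∎)
      where open ≡-Reasoning

    ≋⇒≡-nonneg : ∀ {r r′} k → r ℕ.< n → + r ≡ + r′ + + k * + n → r ≡ r′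
    ≋⇒≡-nonneg {r′ = r′} zero r<n eq = trans (+-*-injective 0 eq) (ℕ.+-identityʳ r′)
    ≋⇒≡-nonneg {r} {r′} (suc k) r<n eq = contradiction r<n (ℕ.≤⇒≯ (begin
      n                  ≤⟨ ℕ.m≤m+n n (k ℕ.* n) ⟩
      suc k ℕ.* n        ≤⟨ ℕ.m≤n+m (suc k ℕ.* n) r′ ⟩
      r′ ℕ.+ suc k ℕ.* n ≡⟨ +-*-injective (suc k) eq ⟨
      r                  ∎))
      where open ℕ.≤-Reasoning

  ≋⇒≡ : ∀ {r r′} → r ℕ.< n → r′ ℕ.< n → + r ≋ + r′ → r ≡ r′
  ≋⇒≡ r<n r′<n (+ k , eq)     = ≋⇒≡-nonneg k r<n eq
  ≋⇒≡ r<n r′<n (-[1+ k ] , eq) = sym (≋⇒≡-nonneg (suc k) r′<n (_≋_.a≡b+quotient*n (≋-sym (-[1+ k ] , eq))))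

  private
    pos-+-* : ∀ a b c → + (a ℕ.+ b ℕ.* c) ≡ + a + + b * + c
    pos-+-* a b c = trans (pos-+ a (b ℕ.* c)) (cong (_+_ (+ a)) (pos-* b c))

    inverseℕ : ∀ m → gcd m n ≡ 1 → ∃ λ m′ → + m * m′ ≋ + 1
    inverseℕ m gcd≡1 with subst (λ g → Bézout.Identity g m n) gcd≡1 (Bézout.identity (gcd-GCD m n))
    ... | Bézout.+- x y 1+yn≡xm = + x , (+ y , (begin
      + m * + x              ≡⟨ lemma (+ m) (+ x) ⟩
      + x * + m              ≡⟨ trans (sym (pos-* x m)) (cong +_ (sym 1+yn≡xm)) ⟩
      + (1 ℕ.+ y ℕ.* n)      ≡⟨ pos-+-* 1 y n ⟩
      + 1 + + y * + n        ∎))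
      where
        open ≡-Reasoning
        lemma : ∀ m x → m * x ≡ x * m
        lemma = solve-∀
    ... | Bézout.-+ x y 1+xm≡yn = - + x , (- + y , (begin
      + m * - + x               ≡⟨ lemma (+ m) (+ x) ⟩
      + 1 - (+ 1 + + x * + m)   ≡⟨ cong (λ z → + 1 - z) (sym (pos-+-* 1 x m)) ⟩
      + 1 - + (1 ℕ.+ x ℕ.* m)   ≡⟨ cong (λ z → + 1 - + z) 1+xm≡yn ⟩
      + 1 - + (y ℕ.* n)         ≡⟨ cong (λ z → + 1 - z) (pos-* y n) ⟩
      + 1 - + y * + n           ≡⟨ lemma′ (+ 1) (+ y) (+ n) ⟩
      + 1 + - + y * + n         ∎))
      where
        open ≡-Reasoning
        lemma : ∀ m x → m * - x ≡ + 1 - (+ 1 + x * m)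
        lemma = solve-∀
        lemma′ : ∀ o y n → o - y * n ≡ o + - y * n
        lemma′ = solve-∀

  record Unit (d : ℤ) : Set where
    constructor _,_
    field
      inverse   : ℤ
      *-inverse : d * inverse ≋ + 1

  coprime⇒unit : ∀ d → CoprimeZ d n → Unit d
  coprime⇒unit (+ m)     gcd≡1 = let m′ , mm′≋1 = inverseℕ m gcd≡1 in m′ , mm′≋1
  coprime⇒unit -[1+ m ] gcd≡1 with inverseℕ (suc m) gcd≡1
  ... | m′ , mm′≋1 = - m′ , ≋-trans (≡⇒≋ (lemma (+ suc m) m′)) mm′≋1
    where lemma : ∀ a b → - a * - b ≡ a * b
          lemma = solve-∀

  +-cancelʳ : ∀ {a b} e → a + e ≋ b + e → a ≋ b
  +-cancelʳ {a} {b} e a+e≋b+e = begin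
    a            ≡⟨ lemma a e ⟩
    a + e - e    ≈⟨ +-congʳ (- e) a+e≋b+e ⟩
    b + e - e    ≡⟨ lemma b e ⟨
    b            ∎
    where
      open ≋-Reasoning
      lemma : ∀ a e → a ≡ a + e - e
      lemma = solve-∀

  *-cancelˡ : ∀ {d a b} → Unit d → d * a ≋ d * b → a ≋ b
  *-cancelˡ {d} {a} {b} (d′ , dd′≋1) da≋db = begin
    a            ≡⟨ lemma₁ a ⟩
    + 1 * a      ≈⟨ *-congʳ a dd′≋1 ⟨
    d * d′ * a   ≡⟨ lemma₂ d d′ a ⟩
    d′ * (d * a) ≈⟨ *-congˡ d′ da≋db ⟩
    d′ * (d * b) ≡⟨ lemma₂ d d′ b ⟨
    d * d′ * b   ≈⟨ *-congʳ b dd′≋1 ⟩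
    + 1 * b      ≡⟨ lemma₁ b ⟨
    b            ∎
    where
      open ≋-Reasoning
      lemma₁ : ∀ a → a ≡ + 1 * a
      lemma₁ = solve-∀
      lemma₂ : ∀ d d′ a → d * d′ * a ≡ d′ * (d * a)
      lemma₂ = solve-∀

  record Affine (t : ℕ → ℕ) (a b : ℤ) : Set where
    field
      bounded    : ∀ x → x ℕ.< n → t x ℕ.< n
      congruence : ∀ x → x ℕ.< n → + t x ≋ a * + x + b

  Σ<-affine : ∀ {g d e} → Affine g d e → CoprimeZ d n → Σ< n g ≡ Σ< n (λ x → x)
  Σ<-affine {g} {d} {e} g-affine d-coprime =
    Σ<-reindex n (λ x → x) g bounded injective surjective
    where
      open Affine g-affine
      d-unit = coprime⇒unit d d-coprime
      open Unit d-unit renaming (inverse to d′; *-inverse to dd′≋1)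

      injective : ∀ x y → x ℕ.< n → y ℕ.< n → g x ≡ g y → x ≡ y
      injective x y x<n y<n gx≡gy = ≋⇒≡ x<n y<n (*-cancelˡ d-unit (+-cancelʳ e (begin
        d * + x + e ≈⟨ congruence x x<n ⟨
        + g x       ≡⟨ cong +_ gx≡gy ⟩
        + g y       ≈⟨ congruence y y<n ⟩
        d * + y + e ∎)))
        where open ≋-Reasoning

      surjective : ∀ y → y ℕ.< n → ∃ λ x → x ℕ.< n × g x ≡ y
      surjective y y<n = x , x<n , ≋⇒≡ (bounded x x<n) y<n (begin
        + g x                  ≈⟨ congruence x x<n ⟩
        d * + x + e            ≈⟨ +-congʳ e (*-congˡ d (%ℕ≋ t)) ⟩
        d * t + e              ≡⟨ lemma d d′ (+ y) e ⟩
        d * d′ * (+ y - e) + e ≈⟨ +-congʳ e (*-congʳ (+ y - e) dd′≋1) ⟩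
        + 1 * (+ y - e) + e    ≡⟨ lemma′ (+ y) e ⟩
        + y                    ∎)
        where
          open ≋-Reasoning
          t = d′ * (+ y - e)
          x = t %ℕ n
          x<n = n%ℕd<d t n
          lemma : ∀ d d′ y e → d * (d′ * (y - e)) + e ≡ d * d′ * (y - e) + e
          lemma = solve-∀
          lemma′ : ∀ y e → + 1 * (y - e) + e ≡ y
          lemma′ = solve-∀

  ᵀ*-cong : ∀ M {u v} → (∀ p → u p ≋ v p) → ∀ q → (M ᵀ* u) q ≋ (M ᵀ* v) q
  ᵀ*-cong M u≋v q =
    +-cong (+-cong (*-congˡ (M zero q) (u≋v zero)) (*-congˡ (M (suc zero) q) (u≋v (suc zero))))
           (*-congˡ (M (suc (suc zero)) q) (u≋v (suc (suc zero))))

  record Affine₂ (f : ℕ → ℕ → ℕ) (a b e : ℤ) : Set where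
    field
      bounded    : ∀ x y → x ℕ.< n → y ℕ.< n → f x y ℕ.< n
      congruence : ∀ x y → x ℕ.< n → y ℕ.< n → + f x y ≋ a * + x + b * + y + e

  fst-affine : Affine₂ (λ x _ → x) (+ 1) (+ 0) (+ 0)
  fst-affine = record
    { bounded    = λ x _ x<n _ → x<n
    ; congruence = λ x y _ _ → ≡⇒≋ (lemma (+ x) (+ y)) }
    where lemma : ∀ x y → x ≡ + 1 * x + + 0 * y + + 0
          lemma = solve-∀

  snd-affine : Affine₂ (λ _ y → y) (+ 0) (+ 1) (+ 0)
  snd-affine = record
    { bounded    = λ _ y _ y<n → y<n
    ; congruence = λ x y _ _ → ≡⇒≋ (lemma (+ x) (+ y)) }
    where lemma : ∀ x y → y ≡ + 0 * x + + 1 * y + + 0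
          lemma = solve-∀

  const-affine : ∀ {c} → c ℕ.< n → Affine₂ (λ _ _ → c) (+ 0) (+ 0) (+ c)
  const-affine {c} c<n = record
    { bounded    = λ _ _ _ _ → c<n
    ; congruence = λ x y _ _ → ≡⇒≋ (lemma (+ x) (+ y) (+ c)) }
    where lemma : ∀ x y c → c ≡ + 0 * x + + 0 * y + c
          lemma = solve-∀

  private
    pos-∸ : ∀ {m k} → k ℕ.≤ m → + (m ℕ.∸ k) ≡ + m - + k
    pos-∸ {m} {k} k≤m = trans (sym (⊖-≥ k≤m)) (sym (m-n≡m⊖n m k))

  reflect-affine : ∀ {f a b e} → Affine₂ f a b e → Affine₂ (λ x y → n ℕ.∸ 1 ℕ.∸ f x y) (- a) (- b) (- + 1 - e)
  reflect-affine {f} {a} {b} {e} f-affine = record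
    { bounded    = λ x y x<n y<n → ℕ.≤-<-trans (ℕ.m∸n≤m (n ℕ.∸ 1) (f x y)) n-1<n
    ; congruence = congruence′ }
    where
      open Affine₂ f-affine
      n-1<n : n ℕ.∸ 1 ℕ.< n
      n-1<n = ℕ.∸-monoʳ-< {n = 1} (ℕ.s≤s ℕ.z≤n) (ℕ.>-nonZero⁻¹ n)
      congruence′ : ∀ x y → x ℕ.< n → y ℕ.< n → + (n ℕ.∸ 1 ℕ.∸ f x y) ≋ - a * + x + - b * + y + (- + 1 - e)
      congruence′ x y x<n y<n = begin
        + (n ℕ.∸ 1 ℕ.∸ f x y)           ≡⟨ trans (pos-∸ (ℕ.<⇒≤pred (bounded x y x<n y<n)))
                                                 (cong (_- + f x y) (pos-∸ (ℕ.>-nonZero⁻¹ n))) ⟩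
        + n - + 1 - + f x y             ≈⟨ +-cong (+-congʳ (- + 1) n≋0) (-‿cong (congruence x y x<n y<n)) ⟩
        + 0 - + 1 - (a * + x + b * + y + e) ≡⟨ lemma a b e (+ x) (+ y) ⟩
        - a * + x + - b * + y + (- + 1 - e) ∎
        where
          open ≋-Reasoning
          lemma : ∀ a b e x y → + 0 - + 1 - (a * x + b * y + e) ≡ - a * x + - b * y + (- + 1 - e)
          lemma = solve-∀

  module _ {f a b e} (f-affine : Affine₂ f a b e) {c} (c<n : c ℕ.< n) where
    open Affine₂ f-affine

    row-affine : Affine (λ x → f x c) a (b * + c + e)
    row-affine = record
      { bounded    = λ x x<n → bounded x c x<n c<n
      ; congruence = λ x x<n → ≋-trans (congruence x c x<n c<n) (≡⇒≋ (lemma a b e (+ x) (+ c))) }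
      where lemma : ∀ a b e x c → a * x + b * c + e ≡ a * x + (b * c + e)
            lemma = solve-∀

    column-affine : Affine (λ y → f c y) b (a * + c + e)
    column-affine = record
      { bounded    = λ y y<n → bounded c y c<n y<n
      ; congruence = λ y y<n → ≋-trans (congruence c y c<n y<n) (≡⇒≋ (lemma a b e (+ y) (+ c))) }
      where lemma : ∀ a b e y c → a * c + b * y + e ≡ b * y + (a * c + e)
            lemma = solve-∀

    diagonal-affine : Affine (λ x → f x ((x ℕ.+ c) ℕ.% n)) (a + b) (b * + c + e)
    diagonal-affine = record
      { bounded    = λ x x<n → bounded x _ x<n (m%n<n _ n)
      ; congruence = congruence′ }
      where
        congruence′ : ∀ x → x ℕ.< n → + f x ((x ℕ.+ c) ℕ.% n) ≋ (a + b) * + x + (b * + c + e)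
        congruence′ x x<n = begin
          + f x y                    ≈⟨ congruence x y x<n (m%n<n _ n) ⟩
          a * + x + b * + y + e      ≈⟨ +-congʳ e (+-congˡ (a * + x) (*-congˡ b (%≋ (x ℕ.+ c)))) ⟩
          a * + x + b * + (x ℕ.+ c) + e ≡⟨ cong (λ z → a * + x + b * z + e) (pos-+ x c) ⟩
          a * + x + b * (+ x + + c) + e ≡⟨ lemma a b e (+ x) (+ c) ⟩
          (a + b) * + x + (b * + c + e) ∎
          where
            open ≋-Reasoning
            y = (x ℕ.+ c) ℕ.% n
            lemma : ∀ a b e x c → a * x + b * (x + c) + e ≡ (a + b) * x + (b * c + e)
            lemma = solve-∀

    antidiagonal-affine : Affine (λ x → f x ((c ℕ.+ (n ℕ.∸ x)) ℕ.% n)) (a - b) (b * + c + e)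
    antidiagonal-affine = record
      { bounded    = λ x x<n → bounded x _ x<n (m%n<n _ n)
      ; congruence = congruence′ }
      where
        congruence′ : ∀ x → x ℕ.< n → + f x ((c ℕ.+ (n ℕ.∸ x)) ℕ.% n) ≋ (a - b) * + x + (b * + c + e)
        congruence′ x x<n = begin
          + f x y                         ≈⟨ congruence x y x<n (m%n<n _ n) ⟩
          a * + x + b * + y + e           ≈⟨ +-congʳ e (+-congˡ (a * + x) (*-congˡ b (%≋ (c ℕ.+ (n ℕ.∸ x))))) ⟩
          a * + x + b * + (c ℕ.+ (n ℕ.∸ x)) + e ≡⟨ cong (λ z → a * + x + b * z + e)
                                                      (trans (pos-+ c (n ℕ.∸ x)) (cong (_+_ (+ c)) (pos-∸ (ℕ.<⇒≤ x<n)))) ⟩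
          a * + x + b * (+ c + (+ n - + x)) + e ≈⟨ +-congʳ e (+-congˡ (a * + x) (*-congˡ b
                                                     (+-congˡ (+ c) (+-congʳ (- + x) n≋0)))) ⟩
          a * + x + b * (+ c + (+ 0 - + x)) + e ≡⟨ lemma a b e (+ x) (+ c) ⟩
          (a - b) * + x + (b * + c + e)   ∎
          where
            open ≋-Reasoning
            y = (c ℕ.+ (n ℕ.∸ x)) ℕ.% n
            lemma : ∀ a b e x c → a * x + b * (c + (+ 0 - x)) + e ≡ (a - b) * x + (b * c + e)
            lemma = solve-∀

magicConstant : ℕ → ℕ
magicConstant n = (n ℕ.* (n ^ 3 ∸ 1)) / 2

digitSums≡magicConstant : ∀ n → let T = Σ< n (λ x → x) in
                          n ^ 2 ℕ.* T ℕ.+ n ℕ.* T ℕ.+ T ≡ magicConstant n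
digitSums≡magicConstant zero    = refl
digitSums≡magicConstant (suc m) = sym (trans (cong (_/ 2) twice) (m*n/n≡m _ 2))
  where
    open ≡-Reasoning
    n = suc m
    T = Σ< n (λ x → x)
    Q = n ^ 2 ℕ.+ n ℕ.+ 1
    cube-pred : ∀ m → (1 ℕ.+ m) ^ 3 ∸ 1 ≡ m ℕ.* ((1 ℕ.+ m) ^ 2 ℕ.+ (1 ℕ.+ m) ℕ.+ 1)
    cube-pred m = trans (cong (_∸ 1) (lemma m)) (ℕ.m+n∸m≡n 1 _)
      where lemma : ∀ m → (1 ℕ.+ m) ℕ.* ((1 ℕ.+ m) ℕ.* ((1 ℕ.+ m) ℕ.* 1))
                        ≡ 1 ℕ.+ m ℕ.* ((1 ℕ.+ m) ℕ.* ((1 ℕ.+ m) ℕ.* 1) ℕ.+ (1 ℕ.+ m) ℕ.+ 1)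
            lemma = ℕ-Solver.solve-∀
    twice : n ℕ.* (n ^ 3 ∸ 1) ≡ (n ^ 2 ℕ.* T ℕ.+ n ℕ.* T ℕ.+ T) ℕ.* 2
    twice = begin
      n ℕ.* (n ^ 3 ∸ 1)                       ≡⟨ cong (n ℕ.*_) (cube-pred m) ⟩
      n ℕ.* (m ℕ.* Q)                         ≡⟨ lemma₁ n m Q ⟩
      Q ℕ.* (n ℕ.* (n ∸ 1))                   ≡⟨ cong (Q ℕ.*_) (Σ<-id n) ⟨
      Q ℕ.* (2 ℕ.* T)                         ≡⟨ lemma₂ n T ⟩
      (n ^ 2 ℕ.* T ℕ.+ n ℕ.* T ℕ.+ T) ℕ.* 2   ∎
      where
        lemma₁ : ∀ n m Q → n ℕ.* (m ℕ.* Q) ≡ Q ℕ.* (n ℕ.* m)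
        lemma₁ = ℕ-Solver.solve-∀
        lemma₂ : ∀ n T → (n ℕ.* (n ℕ.* 1) ℕ.+ n ℕ.+ 1) ℕ.* (2 ℕ.* T)
                       ≡ (n ℕ.* (n ℕ.* 1) ℕ.* T ℕ.+ n ℕ.* T ℕ.+ T) ℕ.* 2
        lemma₂ = ℕ-Solver.solve-∀


Σ<-base-n : ∀ n (c₀ c₁ c₂ : ℕ → ℕ) → Σ< n c₀ ≡ Σ< n (λ x → x) → Σ< n c₁ ≡ Σ< n (λ x → x) →
            Σ< n c₂ ≡ Σ< n (λ x → x) → Σ< n (λ x → n ^ 2 ℕ.* c₀ x ℕ.+ n ℕ.* c₁ x ℕ.+ c₂ x) ≡ magicConstant n
Σ<-base-n n c₀ c₁ c₂ Σc₀ Σc₁ Σc₂ = begin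
  Σ< n (λ x → n ^ 2 ℕ.* c₀ x ℕ.+ n ℕ.* c₁ x ℕ.+ c₂ x)               ≡⟨ Σ<-+ n _ c₂ ⟩
  Σ< n (λ x → n ^ 2 ℕ.* c₀ x ℕ.+ n ℕ.* c₁ x) ℕ.+ Σ< n c₂           ≡⟨ cong (ℕ._+ Σ< n c₂) (Σ<-+ n _ _) ⟩
  Σ< n (λ x → n ^ 2 ℕ.* c₀ x) ℕ.+ Σ< n (λ x → n ℕ.* c₁ x) ℕ.+ Σ< n c₂
    ≡⟨ cong₂ (λ u v → u ℕ.+ v ℕ.+ Σ< n c₂) (Σ<-*ˡ n (n ^ 2) c₀) (Σ<-*ˡ n n c₁) ⟩
  n ^ 2 ℕ.* Σ< n c₀ ℕ.+ n ℕ.* Σ< n c₁ ℕ.+ Σ< n c₂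
    ≡⟨ cong₂ (λ u v → u ℕ.+ v ℕ.+ Σ< n c₂) (cong (n ^ 2 ℕ.*_) Σc₀) (cong (n ℕ.*_) Σc₁) ⟩
  n ^ 2 ℕ.* T ℕ.+ n ℕ.* T ℕ.+ Σ< n c₂ ≡⟨ cong (n ^ 2 ℕ.* T ℕ.+ n ℕ.* T ℕ.+_) Σc₂ ⟩
  n ^ 2 ℕ.* T ℕ.+ n ℕ.* T ℕ.+ T       ≡⟨ digitSums≡magicConstant n ⟩
  magicConstant n                     ∎
  where
    open ≡-Reasoning
    T = Σ< n (λ x → x)

module BaseN (n : ℕ) .{{_ : NonZero n}} where

  digits≡ : ∀ a b c → n ^ 2 ℕ.* a ℕ.+ n ℕ.* b ℕ.+ c ≡ c ℕ.+ (b ℕ.+ a ℕ.* n) ℕ.* n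
  digits≡ a b c = lemma n a b c
    where lemma : ∀ n a b c → n ℕ.* (n ℕ.* 1) ℕ.* a ℕ.+ n ℕ.* b ℕ.+ c ≡ c ℕ.+ (b ℕ.+ a ℕ.* n) ℕ.* n
          lemma = ℕ-Solver.solve-∀

  n^3≡ : n ^ 3 ≡ n ℕ.* n ℕ.* n
  n^3≡ = lemma n
    where lemma : ∀ n → n ℕ.* (n ℕ.* (n ℕ.* 1)) ≡ n ℕ.* n ℕ.* n
          lemma = ℕ-Solver.solve-∀

  digit-< : ∀ {b a m} → b ℕ.< n → a ℕ.< m → b ℕ.+ a ℕ.* n ℕ.< m ℕ.* n
  digit-< {b} {a} b<n a<m = ℕ.<-≤-trans (ℕ.+-monoˡ-< (a ℕ.* n) b<n) (ℕ.*-monoˡ-≤ n a<m)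

  digit-injective : ∀ {b b′ a a′} → b ℕ.< n → b′ ℕ.< n → b ℕ.+ a ℕ.* n ≡ b′ ℕ.+ a′ ℕ.* n → b ≡ b′ × a ≡ a′
  digit-injective {b} {b′} {a} {a′} b<n b′<n eq = b≡b′ , ℕ.*-cancelʳ-≡ a a′ n
    (ℕ.+-cancelˡ-≡ b (a ℕ.* n) (a′ ℕ.* n) (trans eq (cong (ℕ._+ a′ ℕ.* n) (sym b≡b′))))
    where
      open ≡-Reasoning
      b≡b′ : b ≡ b′
      b≡b′ = begin
        b                        ≡⟨ m<n⇒m%n≡m b<n ⟨
        b ℕ.% n                  ≡⟨ [m+kn]%n≡m%n b a n ⟨
        (b ℕ.+ a ℕ.* n) ℕ.% n    ≡⟨ cong (ℕ._% n) eq ⟩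
        (b′ ℕ.+ a′ ℕ.* n) ℕ.% n  ≡⟨ [m+kn]%n≡m%n b′ a′ n ⟩
        b′ ℕ.% n                 ≡⟨ m<n⇒m%n≡m b′<n ⟩
        b′                       ∎

  base-n-< : ∀ {a b c} → a ℕ.< n → b ℕ.< n → c ℕ.< n → n ^ 2 ℕ.* a ℕ.+ n ℕ.* b ℕ.+ c ℕ.< n ^ 3
  base-n-< {a} {b} {c} a<n b<n c<n =
    subst₂ ℕ._<_ (sym (digits≡ a b c)) (sym n^3≡) (digit-< c<n (digit-< b<n a<n))

  base-n-injective : ∀ {a b c a′ b′ c′} → a ℕ.< n → b ℕ.< n → c ℕ.< n → a′ ℕ.< n → b′ ℕ.< n → c′ ℕ.< n →
                     n ^ 2 ℕ.* a ℕ.+ n ℕ.* b ℕ.+ c ≡ n ^ 2 ℕ.* a′ ℕ.+ n ℕ.* b′ ℕ.+ c′ →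
                     a ≡ a′ × b ≡ b′ × c ≡ c′
  base-n-injective {a} {b} {c} {a′} {b′} {c′} _ b<n c<n _ b′<n c′<n eq =
    let c≡c′ , ba≡b′a′ = digit-injective c<n c′<n (trans (sym (digits≡ a b c)) (trans eq (digits≡ a′ b′ c′)))
        b≡b′ , a≡a′    = digit-injective b<n b′<n ba≡b′a′
    in a≡a′ , b≡b′ , c≡c′

  base-n-surjective : ∀ {v} → v ℕ.< n ^ 3 →
                      ∃ λ a → ∃ λ b → ∃ λ c → (a ℕ.< n × b ℕ.< n × c ℕ.< n) × n ^ 2 ℕ.* a ℕ.+ n ℕ.* b ℕ.+ c ≡ v
  base-n-surjective {v} v<n³ = a , b , c , (a<n , m%n<n w n , m%n<n v n) , trans (digits≡ a b c) (sym v≡)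
    where
      c = v ℕ.% n
      w = v ℕ./ n
      b = w ℕ.% n
      a = w ℕ./ n
      v≡ : v ≡ c ℕ.+ (b ℕ.+ a ℕ.* n) ℕ.* n
      v≡ = trans (m≡m%n+[m/n]*n v n) (cong (λ z → c ℕ.+ z ℕ.* n) (m≡m%n+[m/n]*n w n))
      a<n : a ℕ.< n
      a<n = ℕ.≰⇒> λ n≤a → ℕ.<⇒≱ v<n³ (begin
        n ^ 3                       ≡⟨ n^3≡ ⟩
        n ℕ.* n ℕ.* n               ≤⟨ ℕ.*-monoˡ-≤ n (ℕ.*-monoˡ-≤ n n≤a) ⟩
        a ℕ.* n ℕ.* n               ≤⟨ ℕ.*-monoˡ-≤ n (ℕ.m≤n+m (a ℕ.* n) b) ⟩
        (b ℕ.+ a ℕ.* n) ℕ.* n       ≤⟨ ℕ.m≤n+m _ c ⟩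
        c ℕ.+ (b ℕ.+ a ℕ.* n) ℕ.* n ≡⟨ v≡ ⟨
        v                           ∎)
        where open ℕ.≤-Reasoning

module LatinCubes (n : ℕ) .{{_ : NonZero n}} (α : Fin 3 → Fin 3 → ℕ) where

  open Modulo n

  A : Matrix3
  A p q = + α p q

  point : ℕ → ℕ → ℕ → Vector3
  point i j k = vector3 (+ i) (+ j) (+ k)

  latinC≋ : ∀ q i j k → + latinC n α q i j k ≋ (A ᵀ* point i j k) q
  latinC≋ q i j k = ≋-trans (%≋ _) (≡⇒≋ (begin
    + (a ℕ.* i ℕ.+ b ℕ.* j ℕ.+ c ℕ.* k)        ≡⟨ pos-+ (a ℕ.* i ℕ.+ b ℕ.* j) (c ℕ.* k) ⟩
    + (a ℕ.* i ℕ.+ b ℕ.* j) + + (c ℕ.* k)      ≡⟨ cong₂ _+_ (pos-+ (a ℕ.* i) (b ℕ.* j)) (pos-* c k) ⟩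
    + (a ℕ.* i) + + (b ℕ.* j) + + c * + k      ≡⟨ cong₂ (λ u v → u + v + + c * + k) (pos-* a i) (pos-* b j) ⟩
    + a * + i + + b * + j + + c * + k          ∎))
    where
      open ≡-Reasoning
      a = α zero q
      b = α (suc zero) q
      c = α (suc (suc zero)) q

  LatinDirection : Vector3 → Set
  LatinDirection d = ∀ q → CoprimeZ ((A ᵀ* d) q) n

  module _ {I J K a₁ a₂ a₃ b₁ b₂ b₃} (I-affine : Affine I a₁ b₁) (J-affine : Affine J a₂ b₂)
           (K-affine : Affine K a₃ b₃) (latin : LatinDirection (vector3 a₁ a₂ a₃)) where

    Σ<-latinC-line : ∀ q → Σ< n (λ x → latinC n α q (I x) (J x) (K x)) ≡ Σ< n (λ x → x)
    Σ<-latinC-line q = Σ<-affine line-affine (latin q)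
      where
        d = vector3 a₁ a₂ a₃
        e = vector3 b₁ b₂ b₃
        line-affine : Affine (λ x → latinC n α q (I x) (J x) (K x)) ((A ᵀ* d) q) ((A ᵀ* e) q)
        line-affine = record
          { bounded    = λ x _ → m%n<n _ n
          ; congruence = λ x x<n → begin
              + latinC n α q (I x) (J x) (K x)         ≈⟨ latinC≋ q (I x) (J x) (K x) ⟩
              (A ᵀ* point (I x) (J x) (K x)) q         ≈⟨ ᵀ*-cong A (along x x<n) q ⟩
              (A ᵀ* (λ p → d p * + x + e p)) q         ≡⟨ ·-affine (column A q) d e (+ x) ⟩
              (A ᵀ* d) q * + x + (A ᵀ* e) q            ∎ }
          where
            open ≋-Reasoning
            along : ∀ x → x ℕ.< n → ∀ p → point (I x) (J x) (K x) p ≋ d p * + x + e p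
            along x x<n zero             = Affine.congruence I-affine x x<n
            along x x<n (suc zero)       = Affine.congruence J-affine x x<n
            along x x<n (suc (suc zero)) = Affine.congruence K-affine x x<n

    Σ<-M3-line : Σ< n (λ x → M3 n α (I x) (J x) (K x)) ≡ magicConstant n
    Σ<-M3-line = Σ<-base-n n (C zero) (C (suc zero)) (C (suc (suc zero)))
      (Σ<-latinC-line zero) (Σ<-latinC-line (suc zero)) (Σ<-latinC-line (suc (suc zero)))
      where
        C : Fin 3 → ℕ → ℕ
        C q x = latinC n α q (I x) (J x) (K x)

  module _ {I J K a₁ a₂ a₃ b₁ b₂ b₃ e₁ e₂ e₃}
           (I-affine : Affine₂ I a₁ b₁ e₁) (J-affine : Affine₂ J a₂ b₂ e₂) (K-affine : Affine₂ K a₃ b₃ e₃) where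

    rowsSum-square : LatinDirection (vector3 a₁ a₂ a₃) → LatinDirection (vector3 b₁ b₂ b₃) →
                 LatinDirection (vector3 (a₁ + b₁) (a₂ + b₂) (a₃ + b₃)) →
                 LatinDirection (vector3 (a₁ - b₁) (a₂ - b₂) (a₃ - b₃)) →
                 RowsSum n (λ x y → M3 n α (I x y) (J x y) (K x y)) (magicConstant n)
    rowsSum-square latin-row latin-column latin-diagonal latin-antidiagonal c c<n =
        Σ<-M3-line (row-affine I-affine c<n) (row-affine J-affine c<n) (row-affine K-affine c<n) latin-row
      , Σ<-M3-line (column-affine I-affine c<n) (column-affine J-affine c<n) (column-affine K-affine c<n) latin-column
      , Σ<-M3-line (diagonal-affine I-affine c<n) (diagonal-affine J-affine c<n) (diagonal-affine K-affine c<n)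
                   latin-diagonal
      , Σ<-M3-line (antidiagonal-affine I-affine c<n) (antidiagonal-affine J-affine c<n)
                   (antidiagonal-affine K-affine c<n) latin-antidiagonal

  module _ (H : (q : Fin 3) → ColumnConditions n α q) where
    module _ (q : Fin 3) where

      private
        x = A zero q
        y = A (suc zero) q
        z = A (suc (suc zero)) q
        coprime-α    = proj₁ (proj₂ (H q))
        coprime-α±α  = proj₁ (proj₂ (proj₂ (H q)))
        coprime-A    = proj₁ (proj₂ (proj₂ (proj₂ (H q))))
        coprime-A-2α = proj₂ (proj₂ (proj₂ (proj₂ (H q))))
        coprime-α+α : ∀ ℓ ℓ′ → ℓ ≢ ℓ′ → CoprimeZ (+ α ℓ q + + α ℓ′ q) n
        coprime-α+α ℓ ℓ′ ℓ≢ℓ′ = proj₁ (coprime-α±α ℓ ℓ′ ℓ≢ℓ′)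
        coprime-α-α : ∀ ℓ ℓ′ → ℓ ≢ ℓ′ → CoprimeZ (+ α ℓ q - + α ℓ′ q) n
        coprime-α-α ℓ ℓ′ ℓ≢ℓ′ = proj₂ (coprime-α±α ℓ ℓ′ ℓ≢ℓ′)

        coprime-resp : ∀ {a b} → a ≡ b → CoprimeZ a n → CoprimeZ b n
        coprime-resp refl coprime = coprime

        coprime-neg : ∀ {a} → CoprimeZ a n → CoprimeZ (- a) n
        coprime-neg {a} = subst (λ m → gcd m n ≡ 1) (sym (∣-i∣≡∣i∣ a))

      latin₊₀₀ : CoprimeZ ((A ᵀ* vector3 (+ 1) (+ 0) (+ 0)) q) n
      latin₊₀₀ = coprime-resp (lemma x y z) (coprime-α zero)
        where lemma : ∀ x y z → x ≡ x * + 1 + y * + 0 + z * + 0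
              lemma = solve-∀

      latin₀₊₀ : CoprimeZ ((A ᵀ* vector3 (+ 0) (+ 1) (+ 0)) q) n
      latin₀₊₀ = coprime-resp (lemma x y z) (coprime-α (suc zero))
        where lemma : ∀ x y z → y ≡ x * + 0 + y * + 1 + z * + 0
              lemma = solve-∀

      latin₀₀₊ : CoprimeZ ((A ᵀ* vector3 (+ 0) (+ 0) (+ 1)) q) n
      latin₀₀₊ = coprime-resp (lemma x y z) (coprime-α (suc (suc zero)))
        where lemma : ∀ x y z → z ≡ x * + 0 + y * + 0 + z * + 1
              lemma = solve-∀

      latin₊₊₀ : CoprimeZ ((A ᵀ* vector3 (+ 1) (+ 1) (+ 0)) q) n
      latin₊₊₀ = coprime-resp (lemma x y z) (coprime-α+α zero (suc zero) (λ ()))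
        where lemma : ∀ x y z → x + y ≡ x * + 1 + y * + 1 + z * + 0
              lemma = solve-∀

      latin₊₋₀ : CoprimeZ ((A ᵀ* vector3 (+ 1) (- + 1) (+ 0)) q) n
      latin₊₋₀ = coprime-resp (lemma x y z) (coprime-α-α zero (suc zero) (λ ()))
        where lemma : ∀ x y z → x - y ≡ x * + 1 + y * - + 1 + z * + 0
              lemma = solve-∀

      latin₊₀₊ : CoprimeZ ((A ᵀ* vector3 (+ 1) (+ 0) (+ 1)) q) n
      latin₊₀₊ = coprime-resp (lemma x y z) (coprime-α+α zero (suc (suc zero)) (λ ()))
        where lemma : ∀ x y z → x + z ≡ x * + 1 + y * + 0 + z * + 1
              lemma = solve-∀

      latin₊₀₋ : CoprimeZ ((A ᵀ* vector3 (+ 1) (+ 0) (- + 1)) q) n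
      latin₊₀₋ = coprime-resp (lemma x y z) (coprime-α-α zero (suc (suc zero)) (λ ()))
        where lemma : ∀ x y z → x - z ≡ x * + 1 + y * + 0 + z * - + 1
              lemma = solve-∀

      latin₀₊₊ : CoprimeZ ((A ᵀ* vector3 (+ 0) (+ 1) (+ 1)) q) n
      latin₀₊₊ = coprime-resp (lemma x y z) (coprime-α+α (suc zero) (suc (suc zero)) (λ ()))
        where lemma : ∀ x y z → y + z ≡ x * + 0 + y * + 1 + z * + 1
              lemma = solve-∀

      latin₀₊₋ : CoprimeZ ((A ᵀ* vector3 (+ 0) (+ 1) (- + 1)) q) n
      latin₀₊₋ = coprime-resp (lemma x y z) (coprime-α-α (suc zero) (suc (suc zero)) (λ ()))
        where lemma : ∀ x y z → y - z ≡ x * + 0 + y * + 1 + z * - + 1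
              lemma = solve-∀

      latin₊₊₊ : CoprimeZ ((A ᵀ* vector3 (+ 1) (+ 1) (+ 1)) q) n
      latin₊₊₊ = coprime-resp (lemma x y z) (coprime-A)
        where lemma : ∀ x y z → x + y + z ≡ x * + 1 + y * + 1 + z * + 1
              lemma = solve-∀

      latin₊₊₋ : CoprimeZ ((A ᵀ* vector3 (+ 1) (+ 1) (- + 1)) q) n
      latin₊₊₋ = coprime-resp (lemma x y z) (coprime-A-2α (suc (suc zero)))
        where lemma : ∀ x y z → x + y + z - + 2 * z ≡ x * + 1 + y * + 1 + z * - + 1
              lemma = solve-∀

      latin₊₋₊ : CoprimeZ ((A ᵀ* vector3 (+ 1) (- + 1) (+ 1)) q) n
      latin₊₋₊ = coprime-resp (lemma x y z) (coprime-A-2α (suc zero))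
        where lemma : ∀ x y z → x + y + z - + 2 * y ≡ x * + 1 + y * - + 1 + z * + 1
              lemma = solve-∀

      latin₊₋₋ : CoprimeZ ((A ᵀ* vector3 (+ 1) (- + 1) (- + 1)) q) n
      latin₊₋₋ = coprime-resp (lemma x y z) (coprime-neg {x + y + z - + 2 * x} (coprime-A-2α zero))
        where lemma : ∀ x y z → - (x + y + z - + 2 * x) ≡ x * + 1 + y * - + 1 + z * - + 1
              lemma = solve-∀

    constituentRowsSum : ConstituentRowsSum n (M3 n α) (magicConstant n)
    constituentRowsSum =
       (λ c c<n → rowsSum-square (const-affine c<n) fst-affine snd-affine latin₀₊₀ latin₀₀₊ latin₀₊₊ latin₀₊₋)
     , (λ c c<n → rowsSum-square fst-affine (const-affine c<n) snd-affine latin₊₀₀ latin₀₀₊ latin₊₀₊ latin₊₀₋)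
     , (λ c c<n → rowsSum-square fst-affine snd-affine (const-affine c<n) latin₊₀₀ latin₀₊₀ latin₊₊₀ latin₊₋₀)
     , rowsSum-square fst-affine fst-affine snd-affine latin₊₊₀ latin₀₀₊ latin₊₊₊ latin₊₊₋
     , rowsSum-square fst-affine (reflect-affine fst-affine) snd-affine latin₊₋₀ latin₀₀₊ latin₊₋₊ latin₊₋₋
     , rowsSum-square fst-affine snd-affine fst-affine latin₊₀₊ latin₀₊₀ latin₊₊₊ latin₊₋₊
     , rowsSum-square fst-affine snd-affine (reflect-affine fst-affine) latin₊₀₋ latin₀₊₀ latin₊₊₋ latin₊₋₋
     , rowsSum-square fst-affine snd-affine snd-affine latin₊₀₀ latin₀₊₊ latin₊₊₊ latin₊₋₋
     , rowsSum-square fst-affine snd-affine (reflect-affine snd-affine) latin₊₀₀ latin₀₊₋ latin₊₊₋ latin₊₋₊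

  module _ (det-coprime : CoprimeZ (det A) n) where

    private
      det-unit = coprime⇒unit (det A) det-coprime
      open Unit det-unit renaming (inverse to det⁻¹; *-inverse to det*det⁻¹≋1)

    latinC-injective : ∀ {i j k i′ j′ k′} → i ℕ.< n → j ℕ.< n → k ℕ.< n → i′ ℕ.< n → j′ ℕ.< n → k′ ℕ.< n →
                       (∀ q → latinC n α q i j k ≡ latinC n α q i′ j′ k′) → i ≡ i′ × j ≡ j′ × k ≡ k′
    latinC-injective {i} {j} {k} {i′} {j′} {k′} i<n j<n k<n i′<n j′<n k′<n same =
      ≋⇒≡ i<n i′<n (coordinate zero) , ≋⇒≡ j<n j′<n (coordinate (suc zero)) ,
      ≋⇒≡ k<n k′<n (coordinate (suc (suc zero)))
      where
        open ≋-Reasoning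
        u = point i j k
        u′ = point i′ j′ k′
        image : ∀ q → (A ᵀ* u) q ≋ (A ᵀ* u′) q
        image q = begin
          (A ᵀ* u) q              ≈⟨ latinC≋ q i j k ⟨
          + latinC n α q i j k    ≡⟨ cong +_ (same q) ⟩
          + latinC n α q i′ j′ k′ ≈⟨ latinC≋ q i′ j′ k′ ⟩
          (A ᵀ* u′) q             ∎
        coordinate : ∀ r → u r ≋ u′ r
        coordinate r = *-cancelˡ det-unit (begin
          det A * u r               ≡⟨ adjugate-inverseˡ A u r ⟨
          (adjugate A ᵀ* A ᵀ* u) r  ≈⟨ ᵀ*-cong (adjugate A) image r ⟩
          (adjugate A ᵀ* A ᵀ* u′) r ≡⟨ adjugate-inverseˡ A u′ r ⟩
          det A * u′ r              ∎)

    latinC-surjective : ∀ {t₀ t₁ t₂} → t₀ ℕ.< n → t₁ ℕ.< n → t₂ ℕ.< n →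
      ∃ λ i → ∃ λ j → ∃ λ k → (i ℕ.< n × j ℕ.< n × k ℕ.< n) ×
        latinC n α zero i j k ≡ t₀ × latinC n α (suc zero) i j k ≡ t₁ × latinC n α (suc (suc zero)) i j k ≡ t₂
    latinC-surjective {t₀} {t₁} {t₂} t₀<n t₁<n t₂<n =
      u zero , u (suc zero) , u (suc (suc zero)) , (u<n zero , u<n (suc zero) , u<n (suc (suc zero))) ,
      ≋⇒≡ (m%n<n _ n) t₀<n (hits zero) , ≋⇒≡ (m%n<n _ n) t₁<n (hits (suc zero)) ,
      ≋⇒≡ (m%n<n _ n) t₂<n (hits (suc (suc zero)))
      where
        open ≋-Reasoning
        t = vector3 (+ t₀) (+ t₁) (+ t₂)
        w = adjugate A ᵀ* t
        u : Fin 3 → ℕ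
        u r = (w r * det⁻¹) %ℕ n
        u<n : ∀ r → u r ℕ.< n
        u<n r = n%ℕd<d (w r * det⁻¹) n
        u≋ : ∀ r → point (u zero) (u (suc zero)) (u (suc (suc zero))) r ≋ w r * det⁻¹
        u≋ zero             = %ℕ≋ _
        u≋ (suc zero)       = %ℕ≋ _
        u≋ (suc (suc zero)) = %ℕ≋ _
        hits : ∀ q → + latinC n α q (u zero) (u (suc zero)) (u (suc (suc zero))) ≋ t q
        hits q = begin
          + latinC n α q (u zero) (u (suc zero)) (u (suc (suc zero))) ≈⟨ latinC≋ q _ _ _ ⟩
          (A ᵀ* point (u zero) (u (suc zero)) (u (suc (suc zero)))) q ≈⟨ ᵀ*-cong A u≋ q ⟩
          (A ᵀ* (λ r → w r * det⁻¹)) q  ≡⟨ ·-*ʳ (column A q) w det⁻¹ ⟩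
          (A ᵀ* w) q * det⁻¹            ≡⟨ cong (_* det⁻¹) (adjugate-inverseʳ A t q) ⟩
          det A * t q * det⁻¹           ≡⟨ lemma (det A) (t q) det⁻¹ ⟩
          det A * det⁻¹ * t q           ≈⟨ *-congʳ (t q) det*det⁻¹≋1 ⟩
          + 1 * t q                     ≡⟨ *-identityˡ (t q) ⟩
          t q                           ∎
          where lemma : ∀ a b c → a * b * c ≡ a * c * b
                lemma = solve-∀

    private
      C<n : ∀ q i j k → latinC n α q i j k ℕ.< n
      C<n q i j k = m%n<n _ n

    M3-< : ∀ i j k → M3 n α i j k ℕ.< n ^ 3
    M3-< i j k = BaseN.base-n-< n (C<n zero i j k) (C<n (suc zero) i j k) (C<n (suc (suc zero)) i j k)

    M3-injective : ∀ {i j k i′ j′ k′} → i ℕ.< n → j ℕ.< n → k ℕ.< n → i′ ℕ.< n → j′ ℕ.< n → k′ ℕ.< n →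
                   M3 n α i j k ≡ M3 n α i′ j′ k′ → (i , j , k) ≡ (i′ , j′ , k′)
    M3-injective {i} {j} {k} {i′} {j′} {k′} i<n j<n k<n i′<n j′<n k′<n M≡M′ =
      let i≡i′ , j≡j′ , k≡k′ = latinC-injective i<n j<n k<n i′<n j′<n k′<n same
      in cong₂ _,_ i≡i′ (cong₂ _,_ j≡j′ k≡k′)
      where
        same-digits = BaseN.base-n-injective n
          (C<n zero i j k) (C<n (suc zero) i j k) (C<n (suc (suc zero)) i j k)
          (C<n zero i′ j′ k′) (C<n (suc zero) i′ j′ k′) (C<n (suc (suc zero)) i′ j′ k′) M≡M′
        same : ∀ q → latinC n α q i j k ≡ latinC n α q i′ j′ k′
        same zero             = proj₁ same-digits
        same (suc zero)       = proj₁ (proj₂ same-digits)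
        same (suc (suc zero)) = proj₂ (proj₂ same-digits)

    M3-surjective : ∀ {v} → v ℕ.< n ^ 3 → ∃ λ i → ∃ λ j → ∃ λ k → (i ℕ.< n × j ℕ.< n × k ℕ.< n) × M3 n α i j k ≡ v
    M3-surjective v<n³ =
      let t₀ , t₁ , t₂ , (t₀<n , t₁<n , t₂<n) , digits≡v = BaseN.base-n-surjective n v<n³
          i , j , k , i<n,j<n,k<n , C₀≡t₀ , C₁≡t₁ , C₂≡t₂ = latinC-surjective t₀<n t₁<n t₂<n
      in i , j , k , i<n,j<n,k<n ,
         trans (cong₂ ℕ._+_ (cong₂ (λ a b → n ^ 2 ℕ.* a ℕ.+ n ℕ.* b) C₀≡t₀ C₁≡t₁) C₂≡t₂) digits≡v

    entriesExactly : EntriesExactly n (M3 n α)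
    entriesExactly = (λ i j k _ _ _ → M3-< i j k) , λ v v<n³ →
      let i , j , k , (i<n , j<n , k<n) , M≡v = M3-surjective v<n³
      in (i , j , k) , (i<n , j<n , k<n , M≡v) ,
         λ i′ j′ k′ i′<n j′<n k′<n M′≡v → M3-injective i′<n j′<n k′<n i<n j<n k<n (trans M′≡v (sym M≡v))

mainTheorem9 : (n : ℕ) .{{_ : NonZero n}} → n % 2 ≡ 1 →
    (α : Fin 3 → Fin 3 → ℕ) →
    ((q : Fin 3) → ColumnConditions n α q) →
    CoprimeZ (det3 (λ p q → + α p q)) n →
    MagicPandiagonalCube n (M3 n α)
mainTheorem9 n _ α H det-coprime = entriesExactly det-coprime , constituentRowsSum H
  where open LatinCubes n α
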